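{- Let $a$ be an integer with $a>2$ and $S=\langle a,a+1,a+2\rangle$. If $a$ is even, then for $d\in\{1,\dots,a/2\}$, $S_d\cap\operatorname{ULF}(S)=\{(d-1)a+\mu(a+1)+\eta(a+2):\mu\in\{0,1\},\ \eta\in\{d-1,\dots,\tfrac a2-1\}\}\cup\{\lambda a+\mu(a+1)+(d-1)(a+2):\mu\in\{0,1\},\ \lambda\in\{d,\dots,\tfrac a2\}\}.$ If $a$ is odd, then for $d\in\{1,\dots,(a-1)/2\}$, $S_d\cap\operatorname{ULF}(S)=\{(d-1)a+\mu(a+1)+\eta(a+2):\mu\in\{0,1\},\ \eta\in\{d-1,\dots,\tfrac{a-1}2-\mu\}\}\cup\{\lambda a+\mu(a+1)+(d-1)(a+2):\mu\in\{0,1\},\ \lambda\in\{d,\dots,\tfrac{a-1}2+1-\mu\}\},$ while for $d=(a+1)/2$, $S_{(a+1)/2}\cap\operatorname{ULF}(S)=\{\tfrac{a-1}2a+\tfrac{a-1}2(a+2),\ \tfrac{a+1}2a+\tfrac{a-1}2(a+2)\}.$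
   Context: $\mathbb{N}=\{0,1,2,\dots\}$; $S=\langle a,a+1,a+2\rangle=\{\alpha_1a+\alpha_2(a+1)+\alpha_3(a+2):\alpha_i\in\mathbb{N}\}$. For $r\in S$, $\operatorname{F}(r,S)=\{\alpha\in\mathbb{N}^3:\alpha_1a+\alpha_2(a+1)+\alpha_3(a+2)=r\}$, $|\alpha|=\alpha_1+\alpha_2+\alpha_3$, $\operatorname{L}(r,S)=\{|\alpha|:\alpha\in\operatorname{F}(r,S)\}$, $\operatorname{ULF}(S)=\{r\in S:\operatorname{L}(r,S)\text{ has exactly one element}\}$, and $S_d=\{r\in S:\operatorname{card}\operatorname{F}(r,S)=d\}$. -}

module Defs where

open import Data.Nat using (ℕ; _+_; _*_; _≤_)
open import Data.Product using (Σ; ∃; _×_; _,_)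
open import Data.Fin using (Fin)
open import Relation.Binary.PropositionalEquality using (_≡_)
open import Function.Bundles using (_↔_)

ℕ³ : Set
ℕ³ = ℕ × ℕ × ℕ

eval : ℕ → ℕ³ → ℕ
eval a (x , y , z) = x * a + y * (a + 1) + z * (a + 2)

len : ℕ³ → ℕ
len (x , y , z) = x + y + z

IsFact : ℕ → ℕ → ℕ³ → Set
IsFact a r α = eval a α ≡ r

Fact : ℕ → ℕ → Set
Fact a r = Σ ℕ³ (IsFact a r)

InS : ℕ → ℕ → Set
InS a r = ∃ λ α → IsFact a r α

InSd : ℕ → ℕ → ℕ → Set
InSd a d r = InS a r × (Fin d ↔ Fact a r)

InULF : ℕ → ℕ → Set
InULF a r = InS a r × (∃ λ ℓ → (∃ λ α → IsFact a r α × len α ≡ ℓ)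
                              × (∀ α → IsFact a r α → len α ≡ ℓ))

-- Write r = n a + t for a factorisation of length n and excess t = y + 2z ≤ 2n. Lengths of
-- factorisations of r are the m with m a ≤ r ≤ m (a+2), so r has the single length n exactly when
-- t < a and 2n ≤ t + a + 1. Since 2(a+1) = a + (a+2), every such r has a canonical factorisation
-- (x, p, z) with p ≤ 1, and its factorisations are precisely the trades (x - i, p + 2i, z - i),
-- 0 ≤ i ≤ min(x, z); so r ∈ S_d ∩ ULF(S) iff d = 1 + min(x, z). Splitting by which of x, z attains
-- the minimum and solving p + 2z < a, 2x + p ≤ a + 1 for a = 2k and a = 2k + 1 gives the sets.
module Submission where

open import Defs
open import Data.Nat
open import Data.Nat.Properties
open import Data.Nat.DivMod using (_/_; _%_; m≡m%n+[m/n]*n; m%n<n)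
open import Data.Nat.Tactic.RingSolver using (solve-∀)
open import Data.Product using (∃; _×_; _,_; proj₁; proj₂)
open import Data.Sum using (_⊎_; inj₁; inj₂)
open import Data.Fin using (Fin; toℕ; fromℕ<)
open import Data.Fin.Properties using (toℕ-fromℕ<; toℕ-injective; toℕ<n)
open import Data.Fin.Permutation using (↔⇒≡)
open import Relation.Binary.Definitions using (tri<; tri≈; tri>)
open import Relation.Binary.PropositionalEquality
open import Relation.Nullary using (contradiction)
open import Function.Bundles using (_↔_; _⇔_; mk↔ₛ′; mk⇔; module Equivalence)
open import Function.Properties.Inverse using (↔-sym; ↔-trans)
import Function.Properties.Equivalence as ⇔

excess : ℕ³ → ℕ
excess (x , y , z) = y + 2 * z

eval≡len*a+excess : ∀ a α → eval a α ≡ len α * a + excess α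
eval≡len*a+excess a (x , y , z) = identity x y z a
  where
  identity : ∀ x y z a → x * a + y * (a + 1) + z * (a + 2) ≡ (x + y + z) * a + (y + 2 * z)
  identity = solve-∀

excess≤2*len : ∀ α → excess α ≤ 2 * len α
excess≤2*len (x , y , z) = subst (y + 2 * z ≤_) (identity x y z) (m≤m+n (y + 2 * z) (2 * x + y))
  where
  identity : ∀ x y z → y + 2 * z + (2 * x + y) ≡ 2 * (x + y + z)
  identity = solve-∀

shorter⇒smaller : ∀ a {m s n t} → s ≤ 2 * m → 2 * n ≤ t + a + 1 → m < n → m * a + s < n * a + t
shorter⇒smaller a {m} {s} {n} {t} s≤2m 2n≤t+a+1 m<n = +-cancelʳ-≤ (a + 1) _ _ (begin
  suc (m * a + s) + (a + 1)      ≤⟨ +-monoˡ-≤ (a + 1) (s≤s (+-monoʳ-≤ (m * a) s≤2m)) ⟩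
  suc (m * a + 2 * m) + (a + 1)  ≡⟨ identity₁ m a ⟩
  suc m * (a + 2)                ≤⟨ *-monoˡ-≤ (a + 2) m<n ⟩
  n * (a + 2)                    ≡⟨ identity₂ n a ⟩
  n * a + 2 * n                  ≤⟨ +-monoʳ-≤ (n * a) 2n≤t+a+1 ⟩
  n * a + (t + a + 1)            ≡⟨ identity₃ n a t ⟩
  n * a + t + (a + 1)            ∎)
  where
  open ≤-Reasoning
  identity₁ : ∀ m a → suc (m * a + 2 * m) + (a + 1) ≡ suc m * (a + 2)
  identity₁ = solve-∀
  identity₂ : ∀ n a → n * (a + 2) ≡ n * a + 2 * n
  identity₂ = solve-∀
  identity₃ : ∀ n a t → n * a + (t + a + 1) ≡ n * a + t + (a + 1)
  identity₃ = solve-∀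

longer⇒larger : ∀ a {m s n t} → t < a → n < m → n * a + t < m * a + s
longer⇒larger a {m} {s} {n} {t} t<a n<m = begin-strict
  n * a + t  <⟨ +-monoʳ-< (n * a) t<a ⟩
  n * a + a  ≡⟨ +-comm (n * a) a ⟩
  suc n * a  ≤⟨ *-monoˡ-≤ a n<m ⟩
  m * a      ≤⟨ m≤m+n (m * a) s ⟩
  m * a + s  ∎
  where open ≤-Reasoning

length-unique : ∀ a {m s n t} → s ≤ 2 * m → t < a → 2 * n ≤ t + a + 1 → m * a + s ≡ n * a + t → m ≡ n
length-unique a {m} {n = n} s≤2m t<a 2n≤t+a+1 eq with <-cmp m n
... | tri< m<n _ _ = contradiction eq (<⇒≢ (shorter⇒smaller a s≤2m 2n≤t+a+1 m<n))
... | tri≈ _ m≡n _ = m≡n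
... | tri> _ _ n<m = contradiction (sym eq) (<⇒≢ (longer⇒larger a t<a n<m))

factorisation-of-length : ∀ a m s → s ≤ 2 * m → ∃ λ β → len β ≡ m × eval a β ≡ m * a + s
factorisation-of-length a m s s≤2m with ≤-total s m
... | inj₁ s≤m with m≤n⇒∃[o]m+o≡n s≤m
...   | e , refl = (e , s , 0) , identity₁ e s , identity₂ a e s
  where
  identity₁ : ∀ e s → e + s + 0 ≡ s + e
  identity₁ = solve-∀
  identity₂ : ∀ a e s → e * a + s * (a + 1) + 0 * (a + 2) ≡ (s + e) * a + s
  identity₂ = solve-∀
factorisation-of-length a m s s≤2m | inj₂ m≤s with m≤n⇒∃[o]m+o≡n m≤s
... | j , refl with m≤n⇒∃[o]m+o≡n (subst (j ≤_) (+-identityʳ m) (+-cancelˡ-≤ m j (m + 0) s≤2m))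
...   | f , refl = (0 , f , j) , identity₁ j f , identity₂ a j f
  where
  identity₁ : ∀ j f → 0 + f + j ≡ j + f
  identity₁ = solve-∀
  identity₂ : ∀ a j f → 0 * a + f * (a + 1) + j * (a + 2) ≡ (j + f) * a + (j + f + j)
  identity₂ = solve-∀

longer-factorisation : ∀ a {n t} → a ≤ t → t ≤ 2 * n → ∃ λ β → len β ≡ suc n × eval a β ≡ n * a + t
longer-factorisation a {n} a≤t t≤2n with m≤n⇒∃[o]m+o≡n a≤t
... | u , refl =
  let β , lenβ , evalβ = factorisation-of-length a (suc n) u u≤2[1+n]
  in  β , lenβ , trans evalβ (identity n a u)
  where
  u≤2[1+n] : u ≤ 2 * suc n
  u≤2[1+n] = ≤-trans (m≤n+m u a) (≤-trans t≤2n (*-monoʳ-≤ 2 (n≤1+n n)))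
  identity : ∀ n a u → suc n * a + u ≡ n * a + (a + u)
  identity = solve-∀

shorter-factorisation : ∀ a {n t} → t + a + 1 < 2 * suc n → ∃ λ β → len β ≡ n × eval a β ≡ suc n * a + t
shorter-factorisation a {n} {t} t+a+1<2[1+n] =
  let β , lenβ , evalβ = factorisation-of-length a n (a + t) a+t≤2n
  in  β , lenβ , trans evalβ (identity₃ n a t)
  where
  identity₁ : ∀ t a → suc (t + a + 1) ≡ a + t + 2
  identity₁ = solve-∀
  identity₂ : ∀ n → 2 * suc n ≡ 2 * n + 2
  identity₂ = solve-∀
  identity₃ : ∀ n a t → n * a + (a + t) ≡ suc n * a + t
  identity₃ = solve-∀
  a+t≤2n : a + t ≤ 2 * n
  a+t≤2n = +-cancelʳ-≤ 2 (a + t) (2 * n) (subst₂ _≤_ (identity₁ t a) (identity₂ n) t+a+1<2[1+n])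

unique-length⇒excess<a : ∀ a n t → t ≤ 2 * n → (∀ β → IsFact a (n * a + t) β → len β ≡ n) → t < a
unique-length⇒excess<a a n t t≤2n unique = ≰⇒> λ a≤t →
  let β , lenβ , evalβ = longer-factorisation a a≤t t≤2n
  in  1+n≢n (trans (sym lenβ) (unique β evalβ))

unique-length⇒2n≤excess+a+1 : ∀ a n t → (∀ β → IsFact a (n * a + t) β → len β ≡ n) → 2 * n ≤ t + a + 1
unique-length⇒2n≤excess+a+1 a zero t unique = z≤n
unique-length⇒2n≤excess+a+1 a (suc n) t unique = ≮⇒≥ λ t+a+1<2[1+n] →
  let β , lenβ , evalβ = shorter-factorisation a t+a+1<2[1+n]
  in  1+n≢n (trans (sym (unique β evalβ)) lenβ)

-- For p ≤ 1 the last two conditions say that x a + p (a+1) + z (a+2) has no factorisation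
-- of length x + p + z + 1, resp. x + p + z - 1.
data Canonical (a : ℕ) : ℕ³ → Set where
  canonical : ∀ {x p z} → p ≤ 1 → p + 2 * z < a → 2 * x + p ≤ a + 1 → Canonical a (x , p , z)

2*len≤excess+a+1⇔2x+p≤a+1 : ∀ a x p z → (2 * (x + p + z) ≤ p + 2 * z + a + 1) ⇔ (2 * x + p ≤ a + 1)
2*len≤excess+a+1⇔2x+p≤a+1 a x p z = mk⇔
  (λ h → +-cancelʳ-≤ (p + 2 * z) _ _ (subst₂ _≤_ (identity₁ x p z) (identity₂ a p z) h))
  (λ h → subst₂ _≤_ (sym (identity₁ x p z)) (sym (identity₂ a p z)) (+-monoˡ-≤ (p + 2 * z) h))
  where
  identity₁ : ∀ x p z → 2 * (x + p + z) ≡ 2 * x + p + (p + 2 * z)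
  identity₁ = solve-∀
  identity₂ : ∀ a p z → p + 2 * z + a + 1 ≡ a + 1 + (p + 2 * z)
  identity₂ = solve-∀

canonical-lengths : ∀ a {x p z} → Canonical a (x , p , z) → ∀ β → IsFact a (eval a (x , p , z)) β →
                    len β ≡ x + p + z × excess β ≡ p + 2 * z
canonical-lengths a {x} {p} {z} (canonical _ p+2z<a 2x+p≤a+1) β evalβ =
  same-len , +-cancelˡ-≡ ((x + p + z) * a) _ _ (trans (cong (λ n → n * a + excess β) (sym same-len)) eq)
  where
  eq : len β * a + excess β ≡ (x + p + z) * a + (p + 2 * z)
  eq = trans (sym (eval≡len*a+excess a β)) (trans evalβ (eval≡len*a+excess a (x , p , z)))
  same-len : len β ≡ x + p + z
  same-len = length-unique a (excess≤2*len β) p+2z<a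
               (Equivalence.from (2*len≤excess+a+1⇔2x+p≤a+1 a x p z) 2x+p≤a+1) eq

y+2z≡p+2z₁⇒z≤z₁ : ∀ {y z p z₁} → p ≤ 1 → y + 2 * z ≡ p + 2 * z₁ → z ≤ z₁
y+2z≡p+2z₁⇒z≤z₁ {y} {z} {p} {z₁} p≤1 eq = ≮⇒≥ λ z₁<z → <⇒≢ (begin-strict
  p + 2 * z₁  ≤⟨ +-monoˡ-≤ (2 * z₁) p≤1 ⟩
  1 + 2 * z₁  <⟨ subst (_≤ 2 * z) (*-suc 2 z₁) (*-monoʳ-≤ 2 z₁<z) ⟩
  2 * z       ≤⟨ m≤n+m (2 * z) y ⟩
  y + 2 * z   ∎) (sym eq)
  where open ≤-Reasoning

same-len-excess⇒trade : ∀ {x y z x₁ p z₁} → p ≤ 1 → x + y + z ≡ x₁ + p + z₁ → y + 2 * z ≡ p + 2 * z₁ →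
                        ∃ λ i → x + i ≡ x₁ × y ≡ p + 2 * i × z + i ≡ z₁
same-len-excess⇒trade {x} {y} {z} {x₁} {p} {z₁} p≤1 same-len same-excess
  with m≤n⇒∃[o]m+o≡n (y+2z≡p+2z₁⇒z≤z₁ {y} {z} {p} {z₁} p≤1 same-excess)
... | i , refl = i , x+i≡x₁ , y≡p+2i , refl
  where
  open ≡-Reasoning
  identity₁ : ∀ p z i → p + 2 * (z + i) ≡ p + 2 * i + 2 * z
  identity₁ = solve-∀
  identity₂ : ∀ x p i z → x + i + (p + i + z) ≡ x + (p + 2 * i) + z
  identity₂ = solve-∀
  identity₃ : ∀ x₁ p z i → x₁ + p + (z + i) ≡ x₁ + (p + i + z)
  identity₃ = solve-∀
  y≡p+2i : y ≡ p + 2 * i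
  y≡p+2i = +-cancelʳ-≡ (2 * z) y (p + 2 * i) (trans same-excess (identity₁ p z i))
  x+i≡x₁ : x + i ≡ x₁
  x+i≡x₁ = +-cancelʳ-≡ (p + i + z) (x + i) x₁ (begin
    x + i + (p + i + z)  ≡⟨ identity₂ x p i z ⟩
    x + (p + 2 * i) + z  ≡⟨ cong (λ y′ → x + y′ + z) y≡p+2i ⟨
    x + y + z            ≡⟨ same-len ⟩
    x₁ + p + (z + i)     ≡⟨ identity₃ x₁ p z i ⟩
    x₁ + (p + i + z)     ∎)

trade : ℕ³ → ℕ → ℕ³
trade (x , p , z) i = x ∸ i , p + 2 * i , z ∸ i

eval-exchange : ∀ a x y z i → eval a (i + x , y , i + z) ≡ eval a (x , y + 2 * i , z)
eval-exchange a x y z i = identity a x y z i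
  where
  identity : ∀ a x y z i → (i + x) * a + y * (a + 1) + (i + z) * (a + 2) ≡ x * a + (y + 2 * i) * (a + 1) + z * (a + 2)
  identity = solve-∀

eval-trade : ∀ a {x p z i} → i ≤ x ⊓ z → eval a (trade (x , p , z) i) ≡ eval a (x , p , z)
eval-trade a {x} {p} {z} {i} i≤x⊓z = begin
  eval a (x ∸ i , p + 2 * i , z ∸ i)      ≡⟨ eval-exchange a (x ∸ i) p (z ∸ i) i ⟨
  eval a (i + (x ∸ i) , p , i + (z ∸ i))  ≡⟨ cong₂ (λ x′ z′ → eval a (x′ , p , z′)) (m+[n∸m]≡n i≤x) (m+[n∸m]≡n i≤z) ⟩
  eval a (x , p , z)                      ∎
  where
  open ≡-Reasoning
  i≤x = ≤-trans i≤x⊓z (m⊓n≤m x z)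
  i≤z = ≤-trans i≤x⊓z (m⊓n≤n x z)

trade-injective : ∀ α {i j} → trade α i ≡ trade α j → i ≡ j
trade-injective (x , p , z) {i} {j} eq = *-cancelˡ-≡ i j 2 (+-cancelˡ-≡ p _ _ (cong (λ β → proj₁ (proj₂ β)) eq))

factorisations-are-trades : ∀ a {x p z} → Canonical a (x , p , z) → ∀ β → IsFact a (eval a (x , p , z)) β →
                            ∃ λ i → i ≤ x ⊓ z × trade (x , p , z) i ≡ β
factorisations-are-trades a {x} {p} {z} α-canonical@(canonical p≤1 _ _) β@(x′ , y′ , z′) evalβ
  with canonical-lengths a α-canonical β evalβ
... | same-len , same-excess with same-len-excess⇒trade {x′} {y′} {z′} {x} {p} {z} p≤1 same-len same-excess
...   | i , refl , refl , refl =
  i , ⊓-glb (m≤n+m i x′) (m≤n+m i z′) , cong₂ _,_ (m+n∸n≡m x′ i) (cong (_ ,_) (m+n∸n≡m z′ i))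

Fact-≡ : ∀ {a r} {f g : Fact a r} → proj₁ f ≡ proj₁ g → f ≡ g
Fact-≡ {f = α , _} refl = cong (α ,_) (≡-irrelevant _ _)

canonical-factorisations↔ : ∀ a {x p z} → Canonical a (x , p , z) → Fact a (eval a (x , p , z)) ↔ Fin (suc (x ⊓ z))
canonical-factorisations↔ a {x} {p} {z} α-canonical = mk↔ₛ′ index traded index-traded traded-index
  where
  α = (x , p , z)
  decompose : (f : Fact a (eval a α)) → ∃ λ i → i ≤ x ⊓ z × trade α i ≡ proj₁ f
  decompose (β , evalβ) = factorisations-are-trades a α-canonical β evalβ
  index< : (f : Fact a (eval a α)) → proj₁ (decompose f) < suc (x ⊓ z)
  index< f = s≤s (proj₁ (proj₂ (decompose f)))
  index : Fact a (eval a α) → Fin (suc (x ⊓ z))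
  index f = fromℕ< (index< f)
  traded : Fin (suc (x ⊓ z)) → Fact a (eval a α)
  traded j = trade α (toℕ j) , eval-trade a {x} {p} {z} (≤-pred (toℕ<n j))
  index-traded : ∀ j → index (traded j) ≡ j
  index-traded j = toℕ-injective
    (trans (toℕ-fromℕ< (index< (traded j))) (trade-injective α (proj₂ (proj₂ (decompose (traded j))))))
  traded-index : ∀ f → traded (index f) ≡ f
  traded-index f = Fact-≡ (trans (cong (trade α) (toℕ-fromℕ< (index< f))) (proj₂ (proj₂ (decompose f))))

ULF⇒canonical : ∀ a {r} → InULF a r → ∃ λ α → Canonical a α × eval a α ≡ r
ULF⇒canonical a {r} (((x , y , z) , evalxyz) , ℓ , _ , all-ℓ) =
  α , canonical p≤1 p+2z<a (Equivalence.to (2*len≤excess+a+1⇔2x+p≤a+1 a (q + x) p (q + z)) 2len≤excess+a+1) , evalα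
  where
  q = y / 2
  p = y % 2
  α = (q + x , p , q + z)
  p≤1 : p ≤ 1
  p≤1 = ≤-pred (m%n<n y 2)
  y≡p+2q : y ≡ p + 2 * q
  y≡p+2q = trans (m≡m%n+[m/n]*n y 2) (cong (p +_) (*-comm q 2))
  evalα : eval a α ≡ r
  evalα = trans (eval-exchange a x p z q) (trans (cong (λ y′ → eval a (x , y′ , z)) (sym y≡p+2q)) evalxyz)
  unique : ∀ β → IsFact a (len α * a + excess α) β → len β ≡ len α
  unique β evalβ = trans (all-ℓ β (trans evalβ (trans (sym (eval≡len*a+excess a α)) evalα))) (sym (all-ℓ α evalα))
  p+2z<a : p + 2 * (q + z) < a
  p+2z<a = unique-length⇒excess<a a (len α) (excess α) (excess≤2*len α) unique
  2len≤excess+a+1 : 2 * len α ≤ excess α + a + 1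
  2len≤excess+a+1 = unique-length⇒2n≤excess+a+1 a (len α) (excess α) unique

canonical⇒Sd∩ULF : ∀ a {x p z} → Canonical a (x , p , z) →
                   InSd a (suc (x ⊓ z)) (eval a (x , p , z)) × InULF a (eval a (x , p , z))
canonical⇒Sd∩ULF a {x} {p} {z} α-canonical =
  (factorisation , ↔-sym (canonical-factorisations↔ a α-canonical)) ,
  factorisation , x + p + z , ((x , p , z) , refl , refl) ,
  λ β evalβ → proj₁ (canonical-lengths a α-canonical β evalβ)
  where
  factorisation : InS a (eval a (x , p , z))
  factorisation = (x , p , z) , refl

Sd∩ULF⇒canonical : ∀ a {d r} → InSd a d r → InULF a r →
                   ∃ λ x → ∃ λ p → ∃ λ z → Canonical a (x , p , z) × d ≡ suc (x ⊓ z) × eval a (x , p , z) ≡ r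
Sd∩ULF⇒canonical a (_ , Fin-d↔F) ulf with ULF⇒canonical a ulf
... | (x , p , z) , α-canonical , refl =
  x , p , z , α-canonical , ↔⇒≡ (↔-trans Fin-d↔F (canonical-factorisations↔ a α-canonical)) , refl

⊓≡-cases : ∀ {m n o} → m ⊓ n ≡ o → (m ≡ o × o ≤ n) ⊎ (n ≡ o × o < m)
⊓≡-cases {m} {n} m⊓n≡o with ≤-<-connex m n
... | inj₁ m≤n with trans (sym (m≤n⇒m⊓n≡m m≤n)) m⊓n≡o
...   | refl = inj₁ (refl , m≤n)
⊓≡-cases {m} {n} m⊓n≡o | inj₂ n<m with trans (sym (m≥n⇒m⊓n≡n (<⇒≤ n<m))) m⊓n≡o
...   | refl = inj₂ (refl , n<m)

CanonicalMinX : (a c r : ℕ) → Set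
CanonicalMinX a c r = ∃ λ p → ∃ λ z → Canonical a (c , p , z) × c ≤ z × r ≡ eval a (c , p , z)

CanonicalMinZ : (a c r : ℕ) → Set
CanonicalMinZ a c r = ∃ λ p → ∃ λ x → Canonical a (x , p , c) × c < x × r ≡ eval a (x , p , c)

Sd∩ULF⇔canonical : ∀ a c r → (InSd a (suc c) r × InULF a r) ⇔ (CanonicalMinX a c r ⊎ CanonicalMinZ a c r)
Sd∩ULF⇔canonical a c r = mk⇔ split join
  where
  split : InSd a (suc c) r × InULF a r → CanonicalMinX a c r ⊎ CanonicalMinZ a c r
  split (sd , ulf) with Sd∩ULF⇒canonical a sd ulf
  ... | x , p , z , α-canonical , 1+c≡1+x⊓z , eval≡r with ⊓≡-cases (sym (suc-injective 1+c≡1+x⊓z))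
  ...   | inj₁ (refl , c≤z) = inj₁ (p , z , α-canonical , c≤z , sym eval≡r)
  ...   | inj₂ (refl , c<x) = inj₂ (p , x , α-canonical , c<x , sym eval≡r)
  Sd∩ULF : ℕ → ℕ → Set
  Sd∩ULF d r = InSd a d r × InULF a r
  join : CanonicalMinX a c r ⊎ CanonicalMinZ a c r → InSd a (suc c) r × InULF a r
  join (inj₁ (p , z , α-canonical , c≤z , r≡eval)) =
    subst₂ Sd∩ULF (cong suc (m≤n⇒m⊓n≡m c≤z)) (sym r≡eval) (canonical⇒Sd∩ULF a α-canonical)
  join (inj₂ (p , x , α-canonical , c<x , r≡eval)) =
    subst₂ Sd∩ULF (cong suc (m≥n⇒m⊓n≡n (<⇒≤ c<x))) (sym r≡eval) (canonical⇒Sd∩ULF a α-canonical)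

p+2n<2k⇔n<k : ∀ {p n k} → p ≤ 1 → (p + 2 * n < 2 * k) ⇔ (n < k)
p+2n<2k⇔n<k {n = n} {k} z≤n = mk⇔ (*-cancelˡ-< 2 n k) (*-monoʳ-< 2)
p+2n<2k⇔n<k {n = n} {k} (s≤s z≤n) = mk⇔
  (λ 2+2n≤2k → *-cancelˡ-≤ 2 (subst (_≤ 2 * k) (sym (*-suc 2 n)) 2+2n≤2k))
  (λ n<k → subst (_≤ 2 * k) (*-suc 2 n) (*-monoʳ-≤ 2 n<k))

2n+p≤2k+1⇔n≤k : ∀ {p n k} → p ≤ 1 → (2 * n + p ≤ 2 * k + 1) ⇔ (n ≤ k)
2n+p≤2k+1⇔n≤k {p} {n} {k} p≤1 = mk⇔ to (λ n≤k → +-mono-≤ (*-monoʳ-≤ 2 n≤k) p≤1)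
  where
  open ≤-Reasoning
  to : 2 * n + p ≤ 2 * k + 1 → n ≤ k
  to le = m<1+n⇒m≤n (*-cancelˡ-< 2 n (suc k) (begin-strict
    2 * n       ≤⟨ m≤m+n (2 * n) p ⟩
    2 * n + p   ≤⟨ le ⟩
    2 * k + 1   ≡⟨ +-comm (2 * k) 1 ⟩
    suc (2 * k) <⟨ n<1+n (suc (2 * k)) ⟩
    2 + 2 * k   ≡⟨ *-suc 2 k ⟨
    2 * suc k   ∎))

2n+p≤2k⇔n+p≤k : ∀ {p n k} → p ≤ 1 → (2 * n + p ≤ 2 * k) ⇔ (n + p ≤ k)
2n+p≤2k⇔n+p≤k {n = n} {k} z≤n =
  subst₂ (λ 2n+0 n+0 → (2n+0 ≤ 2 * k) ⇔ (n+0 ≤ k)) (sym (+-identityʳ (2 * n))) (sym (+-identityʳ n))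
    (mk⇔ (*-cancelˡ-≤ 2) (*-monoʳ-≤ 2))
2n+p≤2k⇔n+p≤k {n = n} {k} (s≤s z≤n) =
  subst₂ (λ 2n+1 n+1 → (2n+1 ≤ 2 * k) ⇔ (n+1 ≤ k)) (+-comm 1 (2 * n)) (+-comm 1 n)
    (mk⇔ (*-cancelˡ-< 2 n k) (*-monoʳ-< 2))

canonical-even⇔ : ∀ k {x p z} → Canonical (2 * k) (x , p , z) ⇔ (p ≤ 1 × z < k × x ≤ k)
canonical-even⇔ k = mk⇔
  (λ { (canonical p≤1 p+2z<2k 2x+p≤2k+1) →
         p≤1 , Equivalence.to (p+2n<2k⇔n<k p≤1) p+2z<2k , Equivalence.to (2n+p≤2k+1⇔n≤k p≤1) 2x+p≤2k+1 })
  (λ { (p≤1 , z<k , x≤k) →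
         canonical p≤1 (Equivalence.from (p+2n<2k⇔n<k p≤1) z<k) (Equivalence.from (2n+p≤2k+1⇔n≤k p≤1) x≤k) })

canonical-odd⇔ : ∀ k {x p z} → Canonical (2 * k + 1) (x , p , z) ⇔ (p ≤ 1 × z + p ≤ k × x + p ≤ k + 1)
canonical-odd⇔ k {x} {p} {z} = mk⇔
  (λ { (canonical p≤1 p+2z<2k+1 2x+p≤2k+2) →
         p≤1 , Equivalence.to (z-bound p≤1) p+2z<2k+1 , Equivalence.to (x-bound p≤1) 2x+p≤2k+2 })
  (λ { (p≤1 , z+p≤k , x+p≤k+1) →
         canonical p≤1 (Equivalence.from (z-bound p≤1) z+p≤k) (Equivalence.from (x-bound p≤1) x+p≤k+1) })
  where
  identity : ∀ k → 2 * k + 1 + 1 ≡ 2 * (k + 1)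
  identity = solve-∀
  p+2z<2k+1⇔2z+p≤2k : (p + 2 * z < 2 * k + 1) ⇔ (2 * z + p ≤ 2 * k)
  p+2z<2k+1⇔2z+p≤2k rewrite +-comm (2 * k) 1 | +-comm p (2 * z) = mk⇔ m<1+n⇒m≤n s≤s
  z-bound : p ≤ 1 → (p + 2 * z < 2 * k + 1) ⇔ (z + p ≤ k)
  z-bound p≤1 = ⇔.trans p+2z<2k+1⇔2z+p≤2k (2n+p≤2k⇔n+p≤k p≤1)
  x-bound : p ≤ 1 → (2 * x + p ≤ 2 * k + 1 + 1) ⇔ (x + p ≤ k + 1)
  x-bound p≤1 = subst (λ 2k+2 → (2 * x + p ≤ 2k+2) ⇔ (x + p ≤ k + 1)) (sym (identity k)) (2n+p≤2k⇔n+p≤k p≤1)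

m+n≤o≤m⇒m≡o×n≡0 : ∀ {m n o} → m + n ≤ o → o ≤ m → m ≡ o × n ≡ 0
m+n≤o≤m⇒m≡o×n≡0 {m} {n} m+n≤o o≤m =
  ≤-antisym (m+n≤o⇒m≤o m m+n≤o) o≤m ,
  n≤0⇒n≡0 (+-cancelˡ-≤ m n 0 (subst (m + n ≤_) (sym (+-identityʳ m)) (≤-trans m+n≤o o≤m)))

even-case : ∀ {a} k c r → a ≡ 2 * k → c < k →
  (InSd a (suc c) r × InULF a r) ⇔
  ((∃ λ μ → ∃ λ η → μ ≤ 1 × c ≤ η × η ≤ k ∸ 1 × r ≡ eval a (c , μ , η))
   ⊎ (∃ λ μ → ∃ λ λ′ → μ ≤ 1 × suc c ≤ λ′ × λ′ ≤ k × r ≡ eval a (λ′ , μ , c)))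
even-case (suc k) c r refl c<1+k = ⇔.trans (Sd∩ULF⇔canonical _ c r) (mk⇔
  (λ { (inj₁ (μ , η , α-canonical , c≤η , eq)) →
         let μ≤1 , η<1+k , _ = Equivalence.to (canonical-even⇔ (suc k)) α-canonical
         in  inj₁ (μ , η , μ≤1 , c≤η , m<1+n⇒m≤n η<1+k , eq)
     ; (inj₂ (μ , λ′ , α-canonical , c<λ′ , eq)) →
         let μ≤1 , _ , λ′≤1+k = Equivalence.to (canonical-even⇔ (suc k)) α-canonical
         in  inj₂ (μ , λ′ , μ≤1 , c<λ′ , λ′≤1+k , eq) })
  (λ { (inj₁ (μ , η , μ≤1 , c≤η , η≤k , eq)) →
         inj₁ (μ , η , Equivalence.from (canonical-even⇔ (suc k)) (μ≤1 , s≤s η≤k , <⇒≤ c<1+k) , c≤η , eq)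
     ; (inj₂ (μ , λ′ , μ≤1 , c<λ′ , λ′≤1+k , eq)) →
         inj₂ (μ , λ′ , Equivalence.from (canonical-even⇔ (suc k)) (μ≤1 , c<1+k , λ′≤1+k) , c<λ′ , eq) }))

odd-case : ∀ {a} k c r → a ≡ 2 * k + 1 → c < k →
  (InSd a (suc c) r × InULF a r) ⇔
  ((∃ λ μ → ∃ λ η → μ ≤ 1 × c ≤ η × η ≤ k ∸ μ × r ≡ eval a (c , μ , η))
   ⊎ (∃ λ μ → ∃ λ λ′ → μ ≤ 1 × suc c ≤ λ′ × λ′ ≤ k + 1 ∸ μ × r ≡ eval a (λ′ , μ , c)))
odd-case k c r refl c<k = ⇔.trans (Sd∩ULF⇔canonical _ c r) (mk⇔
  (λ { (inj₁ (μ , η , α-canonical , c≤η , eq)) →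
         let μ≤1 , η+μ≤k , _ = Equivalence.to (canonical-odd⇔ k) α-canonical
         in  inj₁ (μ , η , μ≤1 , c≤η , m+n≤o⇒m≤o∸n η η+μ≤k , eq)
     ; (inj₂ (μ , λ′ , α-canonical , c<λ′ , eq)) →
         let μ≤1 , _ , λ′+μ≤k+1 = Equivalence.to (canonical-odd⇔ k) α-canonical
         in  inj₂ (μ , λ′ , μ≤1 , c<λ′ , m+n≤o⇒m≤o∸n λ′ λ′+μ≤k+1 , eq) })
  (λ { (inj₁ (μ , η , μ≤1 , c≤η , η≤k∸μ , eq)) →
         let η+μ≤k = m≤o∸n⇒m+n≤o η (≤-trans μ≤1 1≤k) η≤k∸μ
         in  inj₁ (μ , η , Equivalence.from (canonical-odd⇔ k) (μ≤1 , η+μ≤k , +-mono-≤ (<⇒≤ c<k) μ≤1) , c≤η , eq)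
     ; (inj₂ (μ , λ′ , μ≤1 , c<λ′ , λ′≤k+1∸μ , eq)) →
         let λ′+μ≤k+1 = m≤o∸n⇒m+n≤o λ′ (≤-trans μ≤1 (m≤n+m 1 k)) λ′≤k+1∸μ
         in  inj₂ (μ , λ′ , Equivalence.from (canonical-odd⇔ k) (μ≤1 , c+μ≤k μ≤1 , λ′+μ≤k+1) , c<λ′ , eq) }))
  where
  1≤k : 1 ≤ k
  1≤k = ≤-trans (s≤s z≤n) c<k
  c+μ≤k : ∀ {μ} → μ ≤ 1 → c + μ ≤ k
  c+μ≤k μ≤1 = ≤-trans (+-monoʳ-≤ c μ≤1) (subst (_≤ k) (+-comm 1 c) c<k)

odd-top-case : ∀ {a} k r → a ≡ 2 * k + 1 →
  (InSd a (k + 1) r × InULF a r) ⇔ (r ≡ k * a + k * (a + 2) ⊎ r ≡ (k + 1) * a + k * (a + 2))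
odd-top-case {a} k r refl =
  subst (λ d → (InSd a d r × InULF a r) ⇔ TopElements) (+-comm 1 k) (⇔.trans (Sd∩ULF⇔canonical a k r) (mk⇔ to from))
  where
  TopElements : Set
  TopElements = r ≡ k * a + k * (a + 2) ⊎ r ≡ (k + 1) * a + k * (a + 2)
  k+0≤k : k + 0 ≤ k
  k+0≤k = ≤-reflexive (+-identityʳ k)
  drop-middle : ∀ x → eval a (x , 0 , k) ≡ x * a + k * (a + 2)
  drop-middle x = cong (_+ k * (a + 2)) (+-identityʳ (x * a))
  to : CanonicalMinX a k r ⊎ CanonicalMinZ a k r → TopElements
  to (inj₁ (μ , η , α-canonical , k≤η , eq))
    with m+n≤o≤m⇒m≡o×n≡0 (proj₁ (proj₂ (Equivalence.to (canonical-odd⇔ k) α-canonical))) k≤η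
  ... | refl , refl = inj₁ (trans eq (drop-middle k))
  to (inj₂ (μ , λ′ , α-canonical , k<λ′ , eq))
    with m+n≤o≤m⇒m≡o×n≡0 (proj₂ (proj₂ (Equivalence.to (canonical-odd⇔ k) α-canonical)))
                         (subst (_≤ λ′) (+-comm 1 k) k<λ′)
  ... | refl , refl = inj₂ (trans eq (drop-middle (k + 1)))
  from : TopElements → CanonicalMinX a k r ⊎ CanonicalMinZ a k r
  from (inj₁ eq) =
    inj₁ (0 , k , Equivalence.from (canonical-odd⇔ k) (z≤n , k+0≤k , ≤-trans k+0≤k (m≤m+n k 1)) ,
          ≤-refl , trans eq (sym (drop-middle k)))
  from (inj₂ eq) =
    inj₂ (0 , k + 1 , Equivalence.from (canonical-odd⇔ k) (z≤n , k+0≤k , ≤-reflexive (+-identityʳ (k + 1))) ,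
          m<m+n k (s≤s z≤n) , trans eq (sym (drop-middle (k + 1))))

proposition5p6 : (a : ℕ) → 2 < a →
    -- a even, a = 2k, d ∈ {1,…,a/2}
    ((k : ℕ) → a ≡ 2 * k → (d : ℕ) → 1 ≤ d → d ≤ k → (r : ℕ) →
      (InSd a d r × InULF a r) ⇔
      ((∃ λ μ → ∃ λ η → μ ≤ 1 × d ∸ 1 ≤ η × η ≤ k ∸ 1 ×
          r ≡ (d ∸ 1) * a + μ * (a + 1) + η * (a + 2))
       ⊎ (∃ λ μ → ∃ λ λ' → μ ≤ 1 × d ≤ λ' × λ' ≤ k ×
          r ≡ λ' * a + μ * (a + 1) + (d ∸ 1) * (a + 2))))
    ×
    -- a odd, a = 2k+1, d ∈ {1,…,(a-1)/2}
    ((k : ℕ) → a ≡ 2 * k + 1 → (d : ℕ) → 1 ≤ d → d ≤ k → (r : ℕ) →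
      (InSd a d r × InULF a r) ⇔
      ((∃ λ μ → ∃ λ η → μ ≤ 1 × d ∸ 1 ≤ η × η ≤ k ∸ μ ×
          r ≡ (d ∸ 1) * a + μ * (a + 1) + η * (a + 2))
       ⊎ (∃ λ μ → ∃ λ λ' → μ ≤ 1 × d ≤ λ' × λ' ≤ k + 1 ∸ μ ×
          r ≡ λ' * a + μ * (a + 1) + (d ∸ 1) * (a + 2))))
    ×
    -- a odd, a = 2k+1, d = (a+1)/2 = k+1
    ((k : ℕ) → a ≡ 2 * k + 1 → (r : ℕ) →
      (InSd a (k + 1) r × InULF a r) ⇔
      (r ≡ k * a + k * (a + 2) ⊎ r ≡ (k + 1) * a + k * (a + 2)))
proposition5p6 a _ =
  (λ { k a≡2k (suc c) _ c<k r → even-case k c r a≡2k c<k ; _ _ zero () }) ,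
  (λ { k a≡2k+1 (suc c) _ c<k r → odd-case k c r a≡2k+1 c<k ; _ _ zero () }) ,
  (λ k a≡2k+1 r → odd-top-case k r a≡2k+1)
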